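{- If $G$ and $H$ are finite simple graphs without isolated vertices, then $$\rho(G\times H)\geq \max\{\rho_o(G)\rho(H),\ \rho_o(H)\rho(G)\}.$$
   Context: A packing of a graph $G$ is a set $P\subseteq V(G)$ with $N_G[u]\cap N_G[v]=\emptyset$ for distinct $u,v\in P$ (closed neighborhoods), and $\rho(G)$ is the maximum size of a packing; an open packing is a set $P$ with $N_G(u)\cap N_G(v)=\emptyset$ for distinct $u,v\in P$ (open neighborhoods), and $\rho_o(G)$ is the maximum size of an open packing. The direct product $G\times H$ has vertex set $V(G)\times V(H)$, with $(g,h)$ adjacent to $(g',h')$ iff $gg'\in E(G)$ and $hh'\in E(H)$. -}

module Defs where

open import Level using (0ℓ)
open import Data.Nat using (ℕ; _≤_; _*_)
open import Data.Fin using (Fin; combine; remQuot)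
open import Data.Fin.Subset using (Subset; _∈_; ∣_∣)
open import Data.Product using (_×_; ∃; proj₁; proj₂; _,_)
open import Data.Sum using (_⊎_)
open import Relation.Nullary using (¬_)
open import Relation.Binary.PropositionalEquality using (_≡_)

record Graph : Set₁ where
  field
    n      : ℕ
    Adj    : Fin n → Fin n → Set
    irrefl : ∀ u → ¬ Adj u u
    sym    : ∀ {u v} → Adj u v → Adj v u
open Graph public

NoIsolated : Graph → Set
NoIsolated G = ∀ u → ∃ λ v → Adj G u v

InClosedNbhd : (G : Graph) → Fin (n G) → Fin (n G) → Set
InClosedNbhd G u w = (w ≡ u) ⊎ Adj G u w

InOpenNbhd : (G : Graph) → Fin (n G) → Fin (n G) → Set
InOpenNbhd G u w = Adj G u w

IsPacking : (G : Graph) → Subset (n G) → Set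
IsPacking G P = ∀ u v → u ∈ P → v ∈ P → ¬ (u ≡ v) →
  ∀ w → ¬ (InClosedNbhd G u w × InClosedNbhd G v w)

IsOpenPacking : (G : Graph) → Subset (n G) → Set
IsOpenPacking G P = ∀ u v → u ∈ P → v ∈ P → ¬ (u ≡ v) →
  ∀ w → ¬ (InOpenNbhd G u w × InOpenNbhd G v w)

IsPackingNumber : Graph → ℕ → Set
IsPackingNumber G k =
  (∃ λ P → IsPacking G P × ∣ P ∣ ≡ k) × (∀ P → IsPacking G P → ∣ P ∣ ≤ k)

IsOpenPackingNumber : Graph → ℕ → Set
IsOpenPackingNumber G k =
  (∃ λ P → IsOpenPacking G P × ∣ P ∣ ≡ k) × (∀ P → IsOpenPacking G P → ∣ P ∣ ≤ k)

-- Direct product G × H on Fin (n G * n H), vertex (g,h) encoded as combine g h.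
_×ᵍ_ : Graph → Graph → Graph
G ×ᵍ H = record
  { n      = n G * n H
  ; Adj    = λ x y → Adj G (proj₁ (remQuot {n G} (n H) x)) (proj₁ (remQuot {n G} (n H) y))
                   × Adj H (proj₂ (remQuot {n G} (n H) x)) (proj₂ (remQuot {n G} (n H) y))
  ; irrefl = λ u a → irrefl G _ (proj₁ a)
  ; sym    = λ a → sym G (proj₁ a) , sym H (proj₂ a)
  }

module Submission where

-- A packing is the same as an independent open packing.  If P is an open
-- packing of G and Q a packing of H, then in G × H the set P × Q still has
-- disjoint open neighbourhoods (coordinatewise) and is independent because Q
-- is, so it is a packing of size ∣P∣∣Q∣; symmetrically with the roles swapped.

open import Defs hiding (sym)
open import Data.Nat using (ℕ; _≤_; _*_; _⊔_; _+_; suc)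
open import Data.Nat.Properties using (⊔-lub; *-comm; ≤-trans; ≤-reflexive)
open import Data.Bool using (true; false; _∧_; if_then_else_)
open import Data.Bool.Properties using (∧-conicalˡ; ∧-conicalʳ)
open import Data.Vec using ([]; _∷_; _++_; lookup)
open import Data.Vec.Properties using (lookup-++ˡ; lookup-++ʳ; lookup-replicate; []=⇒lookup; lookup⇒[]=)
open import Data.Fin using (Fin; combine; remQuot; zero; suc; _≟_)
open import Data.Fin.Properties using (combine-remQuot)
open import Data.Fin.Subset using (Subset; _∈_; ∣_∣; ⊥; outside)
open import Data.Fin.Subset.Properties using (∣⊥∣≡0)
open import Data.Product using (_×_; proj₁; proj₂; _,_; uncurry)
open import Data.Sum using (inj₁; inj₂)
open import Relation.Nullary using (¬_; yes; no)
open import Relation.Binary.PropositionalEquality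
  using (_≡_; refl; sym; trans; cong; cong₂; module ≡-Reasoning)

infixr 7 _⊗_

_⊗_ : ∀ {m n} → Subset m → Subset n → Subset (m * n)
[]      ⊗ q = []
(b ∷ p) ⊗ q = (if b then q else ⊥) ++ (p ⊗ q)

∣p++q∣≡∣p∣+∣q∣ : ∀ {m n} (p : Subset m) (q : Subset n) → ∣ p ++ q ∣ ≡ ∣ p ∣ + ∣ q ∣
∣p++q∣≡∣p∣+∣q∣ []          q = refl
∣p++q∣≡∣p∣+∣q∣ (true ∷ p)  q = cong suc (∣p++q∣≡∣p∣+∣q∣ p q)
∣p++q∣≡∣p∣+∣q∣ (false ∷ p) q = ∣p++q∣≡∣p∣+∣q∣ p q

∣p⊗q∣≡∣p∣*∣q∣ : ∀ {m n} (p : Subset m) (q : Subset n) → ∣ p ⊗ q ∣ ≡ ∣ p ∣ * ∣ q ∣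
∣p⊗q∣≡∣p∣*∣q∣ []          q = refl
∣p⊗q∣≡∣p∣*∣q∣ (true ∷ p)  q = begin
  ∣ q ++ p ⊗ q ∣        ≡⟨ ∣p++q∣≡∣p∣+∣q∣ q (p ⊗ q) ⟩
  ∣ q ∣ + ∣ p ⊗ q ∣     ≡⟨ cong (∣ q ∣ +_) (∣p⊗q∣≡∣p∣*∣q∣ p q) ⟩
  ∣ q ∣ + ∣ p ∣ * ∣ q ∣ ∎
  where open ≡-Reasoning
∣p⊗q∣≡∣p∣*∣q∣ {n = n} (false ∷ p) q = begin
  ∣ ⊥ {n} ++ p ⊗ q ∣    ≡⟨ ∣p++q∣≡∣p∣+∣q∣ (⊥ {n}) (p ⊗ q) ⟩
  ∣ ⊥ {n} ∣ + ∣ p ⊗ q ∣ ≡⟨ cong (_+ ∣ p ⊗ q ∣) (∣⊥∣≡0 n) ⟩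
  ∣ p ⊗ q ∣             ≡⟨ ∣p⊗q∣≡∣p∣*∣q∣ p q ⟩
  ∣ p ∣ * ∣ q ∣         ∎
  where open ≡-Reasoning

lookup-⊗ : ∀ {m n} (p : Subset m) (q : Subset n) i j →
           lookup (p ⊗ q) (combine i j) ≡ lookup p i ∧ lookup q j
lookup-⊗ (true ∷ p)  q zero    j = lookup-++ˡ q (p ⊗ q) j
lookup-⊗ (false ∷ p) q zero    j = trans (lookup-++ˡ ⊥ (p ⊗ q) j) (lookup-replicate j outside)
lookup-⊗ (b ∷ p)     q (suc i) j =
  trans (lookup-++ʳ (if b then q else ⊥) (p ⊗ q) (combine i j)) (lookup-⊗ p q i j)

x∈p⊗q⇒remQuot∈ : ∀ {m n} (p : Subset m) (q : Subset n) {x} → x ∈ p ⊗ q →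
                 proj₁ (remQuot {m} n x) ∈ p × proj₂ (remQuot {m} n x) ∈ q
x∈p⊗q⇒remQuot∈ {m} {n} p q {x} x∈p⊗q =
  lookup⇒[]= i p (∧-conicalˡ _ _ p∧q) , lookup⇒[]= j q (∧-conicalʳ _ _ p∧q)
  where
  i = proj₁ (remQuot {m} n x)
  j = proj₂ (remQuot {m} n x)
  p∧q : lookup p i ∧ lookup q j ≡ true
  p∧q = begin
    lookup p i ∧ lookup q j      ≡⟨ sym (lookup-⊗ p q i j) ⟩
    lookup (p ⊗ q) (combine i j) ≡⟨ cong (lookup (p ⊗ q)) (combine-remQuot {m} n x) ⟩
    lookup (p ⊗ q) x             ≡⟨ []=⇒lookup x∈p⊗q ⟩
    true                         ∎
    where open ≡-Reasoning

remQuot-injective : ∀ {m} n {x y : Fin (m * n)} → remQuot {m} n x ≡ remQuot n y → x ≡ y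
remQuot-injective {m} n {x} {y} eq = begin
  x                                 ≡⟨ sym (combine-remQuot {m} n x) ⟩
  uncurry combine (remQuot {m} n x) ≡⟨ cong (uncurry combine) eq ⟩
  uncurry combine (remQuot {m} n y) ≡⟨ combine-remQuot {m} n y ⟩
  y                                 ∎
  where open ≡-Reasoning

Independent : (G : Graph) → Subset (n G) → Set
Independent G P = ∀ u v → u ∈ P → v ∈ P → ¬ Adj G u v

packing⇒openPacking : ∀ G {P} → IsPacking G P → IsOpenPacking G P
packing⇒openPacking G pack u v u∈P v∈P u≢v w (uw , vw) =
  pack u v u∈P v∈P u≢v w (inj₂ uw , inj₂ vw)

packing⇒independent : ∀ G {P} → IsPacking G P → Independent G P
packing⇒independent G pack u v u∈P v∈P uv =
  pack u v u∈P v∈P (λ { refl → irrefl G u uv }) v (inj₂ uv , inj₁ refl)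

independent-openPacking⇒packing : ∀ G {P} → Independent G P → IsOpenPacking G P → IsPacking G P
independent-openPacking⇒packing G indep openP u v u∈P v∈P u≢v w (inj₁ refl , inj₁ refl) = u≢v refl
independent-openPacking⇒packing G indep openP u v u∈P v∈P u≢v w (inj₁ refl , inj₂ vu) =
  indep v u v∈P u∈P vu
independent-openPacking⇒packing G indep openP u v u∈P v∈P u≢v w (inj₂ uv , inj₁ refl) =
  indep u v u∈P v∈P uv
independent-openPacking⇒packing G indep openP u v u∈P v∈P u≢v w (inj₂ uw , inj₂ vw) =
  openP u v u∈P v∈P u≢v w (uw , vw)

module _ (G H : Graph) {P : Subset (n G)} {Q : Subset (n H)} where

  private
    π₁ : Fin (n G * n H) → Fin (n G)
    π₁ x = proj₁ (remQuot {n G} (n H) x)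

    π₂ : Fin (n G * n H) → Fin (n H)
    π₂ x = proj₂ (remQuot {n G} (n H) x)

    π₁∈P : ∀ {x} → x ∈ P ⊗ Q → π₁ x ∈ P
    π₁∈P x∈ = proj₁ (x∈p⊗q⇒remQuot∈ P Q x∈)

    π₂∈Q : ∀ {x} → x ∈ P ⊗ Q → π₂ x ∈ Q
    π₂∈Q x∈ = proj₂ (x∈p⊗q⇒remQuot∈ P Q x∈)

  ⊗-independentˡ : Independent G P → Independent (G ×ᵍ H) (P ⊗ Q)
  ⊗-independentˡ indep u v u∈ v∈ (uv , _) = indep (π₁ u) (π₁ v) (π₁∈P u∈) (π₁∈P v∈) uv

  ⊗-independentʳ : Independent H Q → Independent (G ×ᵍ H) (P ⊗ Q)
  ⊗-independentʳ indep u v u∈ v∈ (_ , uv) = indep (π₂ u) (π₂ v) (π₂∈Q u∈) (π₂∈Q v∈) uv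

  ⊗-openPacking : IsOpenPacking G P → IsOpenPacking H Q → IsOpenPacking (G ×ᵍ H) (P ⊗ Q)
  ⊗-openPacking openG openH u v u∈ v∈ u≢v w ((uw₁ , uw₂) , (vw₁ , vw₂))
    with π₁ u ≟ π₁ v | π₂ u ≟ π₂ v
  ... | no u₁≢v₁  | _          = openG (π₁ u) (π₁ v) (π₁∈P u∈) (π₁∈P v∈) u₁≢v₁ (π₁ w) (uw₁ , vw₁)
  ... | yes _     | no u₂≢v₂   = openH (π₂ u) (π₂ v) (π₂∈Q u∈) (π₂∈Q v∈) u₂≢v₂ (π₂ w) (uw₂ , vw₂)
  ... | yes u₁≡v₁ | yes u₂≡v₂ = u≢v (remQuot-injective {n G} (n H) (cong₂ _,_ u₁≡v₁ u₂≡v₂))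

  openPacking⊗packing : IsOpenPacking G P → IsPacking H Q → IsPacking (G ×ᵍ H) (P ⊗ Q)
  openPacking⊗packing openG packH = independent-openPacking⇒packing (G ×ᵍ H)
    (⊗-independentʳ (packing⇒independent H packH))
    (⊗-openPacking openG (packing⇒openPacking H packH))

  packing⊗openPacking : IsPacking G P → IsOpenPacking H Q → IsPacking (G ×ᵍ H) (P ⊗ Q)
  packing⊗openPacking packG openH = independent-openPacking⇒packing (G ×ᵍ H)
    (⊗-independentˡ (packing⇒independent G packG))
    (⊗-openPacking (packing⇒openPacking G packG) openH)

corollary12 : (G H : Graph) → NoIsolated G → NoIsolated H →
    (ρG ρH ρoG ρoH ρGH : ℕ) →
    IsPackingNumber G ρG → IsPackingNumber H ρH →
    IsOpenPackingNumber G ρoG → IsOpenPackingNumber H ρoH →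
    IsPackingNumber (G ×ᵍ H) ρGH →
    (ρoG * ρH) ⊔ (ρoH * ρG) ≤ ρGH
corollary12 G H _ _ ρG ρH ρoG ρoH ρGH
  ((P , packP , refl) , _) ((Q , packQ , refl) , _)
  ((O , openO , refl) , _) ((O′ , openO′ , refl) , _) (_ , maximal) =
  ⊔-lub (≤-trans (≤-reflexive (sym (∣p⊗q∣≡∣p∣*∣q∣ O Q)))
                 (maximal (O ⊗ Q) (openPacking⊗packing G H openO packQ)))
        (≤-trans (≤-reflexive (trans (*-comm ∣ O′ ∣ ∣ P ∣) (sym (∣p⊗q∣≡∣p∣*∣q∣ P O′))))
                 (maximal (P ⊗ O′) (packing⊗openPacking G H packP openO′)))
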